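{- Let $D=(\mathcal V,\mathcal A)$ be an $\mathscr{F}$-free digraph and $v\in\mathcal V$. Write $\mathcal V_1=N^+(v)$ and $\mathcal V_2=\mathcal V\setminus\mathcal V_1$. If there is a walk $t_1\to t_2\to t_3$ with $t_1,t_2,t_3\in\mathcal V_1$, and $N^+(u)=\mathcal V_1$ for all $u\in\mathcal V_2$, then $t_1$ has no out-neighbour in $\mathcal V_2$.
   Context: Digraphs are strict (no loops, no parallel arcs). $N^+(u)$ is the set of out-neighbours of $u$. A digraph is $\mathscr{F}$-free if it does not contain two distinct walks of length 2 (sequences $u\to a\to w$ of arcs, $u=w$ allowed) with the same initial and terminal vertices. The walk $t_1\to t_2\to t_3$ may have $t_1=t_3$. -}

module Defs where

open import Data.Nat using (ℕ)
open import Data.Fin using (Fin)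
open import Level using (Level; suc; _⊔_)
open import Relation.Binary.PropositionalEquality using (_≡_)
open import Relation.Nullary using (¬_)

record Digraph (n : ℕ) : Set₁ where
  field
    Arc      : Fin n → Fin n → Set
    loopless : ∀ u → ¬ Arc u u
open Digraph public

_∈N⁺_ : ∀ {n} {D : Digraph n} → Fin n → Fin n → Set
_∈N⁺_ {D = D} x u = Arc D u x

-- F-free: no two distinct walks u → a → w and u → b → w of length 2
-- (u = w allowed). Two such walks are equal iff their middle vertices are.
FFree : ∀ {n} → Digraph n → Set
FFree {n} D = ∀ (u a b w : Fin n) →
  Arc D u a → Arc D a w → Arc D u b → Arc D b w → a ≡ b

module Submission where

open import Defs
open import Data.Nat using (ℕ)
open import Data.Fin using (Fin)
open import Relation.Nullary using (¬_)
open import Function.Bundles using (_⇔_; Equivalence)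
open import Relation.Binary.PropositionalEquality using (_≡_; subst)

-- An out-neighbour x of t₁ outside N⁺(v) also points to t₃ ∈ N⁺(v), so t₁ → x → t₃
-- competes with t₁ → t₂ → t₃; F-freeness forces x = t₂ ∈ N⁺(v), a contradiction.

lemma3 : ∀ {n : ℕ} (D : Digraph n) → FFree D → (v : Fin n) →
    (t₁ t₂ t₃ : Fin n) →
    Arc D v t₁ → Arc D v t₂ → Arc D v t₃ →
    Arc D t₁ t₂ → Arc D t₂ t₃ →
    (∀ (u : Fin n) → ¬ Arc D v u → (∀ (x : Fin n) → Arc D u x ⇔ Arc D v x)) →
    ∀ (x : Fin n) → Arc D t₁ x → ¬ ¬ Arc D v x
lemma3 D ff v t₁ t₂ t₃ _ v→t₂ v→t₃ t₁→t₂ t₂→t₃ outside-sees-N⁺v x t₁→x v↛x =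
  v↛x (subst (Arc D v) t₂≡x v→t₂)
  where
    x→t₃ : Arc D x t₃
    x→t₃ = Equivalence.from (outside-sees-N⁺v x v↛x t₃) v→t₃

    t₂≡x : t₂ ≡ x
    t₂≡x = ff t₁ t₂ x t₃ t₁→t₂ t₂→t₃ t₁→x x→t₃
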